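{- There exists an absolute constant $C>0$ such that the following holds. Let $y \geq 3$ be an integer. If $n \geq \max(C,\,160y^2+1)$, then there exists a connected graph $G$ on $n$ vertices satisfying the $(y-1)$-strong neighbourhood property and having maximum vertex degree at most $\max(32\log n,\,8y)$.
   Context: All graphs are finite and simple; $\log$ denotes the natural logarithm. For a vertex $v$, $N(v)$ is the set of vertices adjacent to $v$ (not including $v$), and $N[v] = N(v)\cup\{v\}$; $\#A$ denotes the cardinality of a set $A$. For an integer $k\ge 1$, a graph $G$ has the $k$-strong neighbourhood property if for any two distinct vertices $u,v$ of $G$, $\#\big(N[v]\setminus N[u]\big) \geq k$. -}

module Defs where

open import Data.Nat using (ℕ; zero; suc; _+_; _*_; _∸_; _^_; _≤_; _!)
open import Data.Nat.Combinatorics using (_P_)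
open import Data.Fin using (Fin; zero; suc; _≟_)
open import Data.Bool using (Bool; true; false; _∧_; _∨_; not; if_then_else_)
open import Relation.Nullary.Decidable using (⌊_⌋)
open import Relation.Binary.PropositionalEquality using (_≡_)
open import Relation.Nullary using (¬_)

record Graph (n : ℕ) : Set where
  field
    adj   : Fin n → Fin n → Bool
    sym   : ∀ u v → adj u v ≡ adj v u
    irrefl : ∀ v → adj v v ≡ false
open Graph public

count : ∀ {n} → (Fin n → Bool) → ℕ
count {zero} p = 0
count {suc n} p = (if p zero then 1 else 0) + count (λ i → p (suc i))

inN : ∀ {n} → Graph n → Fin n → Fin n → Bool
inN G v w = adj G v w

inClosedN : ∀ {n} → Graph n → Fin n → Fin n → Bool
inClosedN G v w = ⌊ w ≟ v ⌋ ∨ adj G v w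

degree : ∀ {n} → Graph n → Fin n → ℕ
degree G v = count (inN G v)

data Reach {n} (G : Graph n) : Fin n → Fin n → Set where
  here : ∀ {u} → Reach G u u
  step : ∀ {u w v} → adj G u w ≡ true → Reach G w v → Reach G u v

Connected : ∀ {n} → Graph n → Set
Connected {n} G = (u v : Fin n) → Reach G u v

StrongNbhd : ∀ {n} → ℕ → Graph n → Set
StrongNbhd {n} k G = (u v : Fin n) → ¬ (u ≡ v) →
  k ≤ count (λ w → inClosedN G v w ∧ not (inClosedN G u w))

-- Σ_{k=0}^{K} d^k * K!/k!   (note K P (K ∸ k) = K!/k! for k ≤ K)
expSumScaled : ℕ → ℕ → ℕ
expSumScaled d K = go K
  where
  go : ℕ → ℕ
  go zero = K P K
  go (suc k) = d ^ suc k * (K P (K ∸ suc k)) + go k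

-- d ≤ 32 log n  ⇔  e^d ≤ n^32  ⇔  ∀ K, Σ_{k≤K} d^k/k! ≤ n^32
LeThirtyTwoLog : ℕ → ℕ → Set
LeThirtyTwoLog d n = ∀ K → expSumScaled d K ≤ n ^ 32 * K !

-- Put K = y − 1 and pick a block length q ≥ 2K with (K + 1)q + 2K ≤ n ≤ (K + 2)q. Vertex
-- k < n has offset k mod q and block k div q, so there are K + 1 full blocks followed by a
-- block containing at least the offsets below 2K. Join two vertices when they have the same
-- offset, or lie in the same block with offsets at most K apart. A closed neighbourhood lies in
-- the union of an offset class (at most K + 2 vertices) and 2K + 1 consecutive offsets of one
-- block.
-- For u ≠ v with equal offsets, N[v] ∖ N[u] contains K vertices of v's block on one side of
-- v; with different offsets it contains v's offset class in the first K + 1 blocks, except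
-- possibly the vertex in u's block. Every k > 0 is adjacent to k − 1, or to k − q when its
-- offset is 0, so the graph is connected.

{-# OPTIONS --safe #-}
module Submission where

open import Defs
open import Data.Nat using (ℕ; _+_; _*_; _^_; _≤_; _∸_)
open import Data.Fin using (Fin)
open import Data.Product using (∃; _×_)
open import Data.Sum using (_⊎_)

open import Level using (0ℓ)
open import Algebra.Properties.CommutativeSemigroup using (interchange)
open import Data.Bool using (Bool; true; false; T; not; _∧_; _∨_; if_then_else_)
open import Data.Empty using (⊥-elim)
open import Data.Fin as Fin using (zero; suc; toℕ; fromℕ<)
open import Data.Fin.Induction using (<-wellFounded)
open import Data.Fin.Properties using (toℕ<n; toℕ-fromℕ<; toℕ-injective)
open import Data.Nat
  using (zero; suc; _<_; z≤n; s≤s; s≤s⁻¹; z<s; ∣_-_∣; _≟_; _≤?_; NonZero; >-nonZero⁻¹; _/_; _%_)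
open import Data.Nat.DivMod
open import Data.Nat.Properties
open import Data.Nat.Tactic.RingSolver using (solve-∀)
open import Data.Product using (_,_; proj₁; proj₂; ∃-syntax)
open import Data.Sum using (inj₁; inj₂; [_,_]′)
open import Data.Unit using (tt)
open import Function using (_∘_; mk⇔)
open import Induction.WellFounded using (Acc; acc)
open import Relation.Binary using (Rel; Reflexive; Symmetric)
open import Relation.Binary.PropositionalEquality as ≡ using (_≡_; _≢_; refl; cong; cong₂; subst)
open import Relation.Nullary using (Dec; yes; no; does; ¬_)
open import Relation.Nullary.Decidable using (_×-dec_; _⊎-dec_; dec-true; dec-false; does-⇔)
open import Relation.Unary using (Pred; Decidable)
open import Relation.Unary.Properties using (_∩?_; _∪?_; ∁?)

indicator : Bool → ℕ
indicator b = if b then 1 else 0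

indicator-mono : ∀ a b → (T a → T b) → indicator a ≤ indicator b
indicator-mono false _ _ = z≤n
indicator-mono true true _ = ≤-refl
indicator-mono true false a⇒b = ⊥-elim (a⇒b tt)

indicator-pos : ∀ {b} → T b → 1 ≤ indicator b
indicator-pos {true} _ = ≤-refl

count-mono : ∀ {n} {p p′ : Fin n → Bool} →
  (∀ i → T (p i) → T (p′ i)) → count p ≤ count p′
count-mono {zero} _ = z≤n
count-mono {suc n} {p} {p′} p⇒p′ =
  +-mono-≤ (indicator-mono (p zero) (p′ zero) (p⇒p′ zero)) (count-mono (p⇒p′ ∘ suc))

count-none : ∀ {n} {p : Fin n → Bool} → (∀ i → ¬ T (p i)) → count p ≡ 0
count-none {zero} _ = refl
count-none {suc n} {p} none =
  cong₂ _+_ (indicator-false (p zero) (none zero)) (count-none (none ∘ suc))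
  where
  indicator-false : ∀ b → ¬ T b → indicator b ≡ 0
  indicator-false false _ = refl
  indicator-false true ¬t = ⊥-elim (¬t tt)

count-partition : ∀ {n} (p s : Fin n → Bool) →
  count p ≡ count (λ i → p i ∧ s i) + count (λ i → p i ∧ not (s i))
count-partition {zero} _ _ = refl
count-partition {suc n} p s = ≡.trans
  (cong₂ _+_ (indicator-split (p zero) (s zero)) (count-partition (p ∘ suc) (s ∘ suc)))
  (interchange +-commutativeSemigroup
    (indicator (p zero ∧ s zero)) (indicator (p zero ∧ not (s zero)))
    (count (λ i → p (suc i) ∧ s (suc i))) (count (λ i → p (suc i) ∧ not (s (suc i)))))
  where
  indicator-split : ∀ a b → indicator a ≡ indicator (a ∧ b) + indicator (a ∧ not b)
  indicator-split false _ = refl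
  indicator-split true true = refl
  indicator-split true false = refl

count-∨ : ∀ {n} (p p′ : Fin n → Bool) → count (λ i → p i ∨ p′ i) ≤ count p + count p′
count-∨ p p′ = begin
  count (λ i → p i ∨ p′ i)
    ≡⟨ count-partition _ p ⟩
  count (λ i → (p i ∨ p′ i) ∧ p i) + count (λ i → (p i ∨ p′ i) ∧ not (p i))
    ≤⟨ +-mono-≤ (count-mono λ i → left (p i) (p′ i)) (count-mono λ i → right (p i) (p′ i)) ⟩
  count p + count p′ ∎
  where
  open ≤-Reasoning
  left : ∀ a b → T ((a ∨ b) ∧ a) → T a
  left true _ _ = tt
  left false true ()
  left false false ()
  right : ∀ a b → T ((a ∨ b) ∧ not a) → T b
  right false true _ = tt
  right false false ()
  right true _ ()

does-sound : ∀ {A : Set} (a? : Dec A) → T (does a?) → A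
does-sound (yes a) _ = a

does-complete : ∀ {A : Set} (a? : Dec A) → A → T (does a?)
does-complete (yes _) _ = tt
does-complete (no ¬a) a = ¬a a

countBelow : (n : ℕ) {P : Pred ℕ 0ℓ} → Decidable P → ℕ
countBelow n P? = count (λ (i : Fin n) → does (P? (toℕ i)))

module _ (n : ℕ) {P Q : Pred ℕ 0ℓ} (P? : Decidable P) (Q? : Decidable Q) where

  countBelow-mono : (∀ {k} → k < n → P k → Q k) → countBelow n P? ≤ countBelow n Q?
  countBelow-mono P⇒Q =
    count-mono {n} λ i → does-complete (Q? _) ∘ P⇒Q (toℕ<n i) ∘ does-sound (P? _)

  countBelow-partition : countBelow n P? ≡ countBelow n (P? ∩? Q?) + countBelow n (P? ∩? ∁? Q?)
  countBelow-partition =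
    count-partition (λ (i : Fin n) → does (P? (toℕ i))) (λ i → does (Q? (toℕ i)))

  countBelow-∪ : countBelow n (P? ∪? Q?) ≤ countBelow n P? + countBelow n Q?
  countBelow-∪ = count-∨ (λ (i : Fin n) → does (P? (toℕ i))) (λ i → does (Q? (toℕ i)))

countBelow-singleton : ∀ n x → countBelow n (_≟ x) ≤ 1
countBelow-singleton zero _ = z≤n
countBelow-singleton (suc n) zero =
  ≤-reflexive (cong suc (count-none {n} {λ i → does (suc (toℕ i) ≟ 0)} λ _ ()))
countBelow-singleton (suc n) (suc x) = countBelow-singleton n x

countBelow-pos : ∀ {n x} {P : Pred ℕ 0ℓ} (P? : Decidable P) →
  x < n → P x → 1 ≤ countBelow n P?
countBelow-pos {suc n} {zero} P? _ Px =
  ≤-trans (indicator-pos (does-complete (P? 0) Px)) (m≤m+n _ _)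
countBelow-pos {suc n} {suc x} {P} P? (s≤s x<n) Px =
  ≤-trans (countBelow-pos {P = P ∘ suc} (P? ∘ suc) x<n Px) (m≤n+m _ _)

injective⇒≤countBelow : ∀ {n m} {P : Pred ℕ 0ℓ} (P? : Decidable P) (g : ℕ → ℕ) →
  (∀ {i j} → g i ≡ g j → i ≡ j) → (∀ {i} → i < m → g i < n × P (g i)) →
  m ≤ countBelow n P?
injective⇒≤countBelow {m = zero} _ _ _ _ = z≤n
injective⇒≤countBelow {n} {suc m} {P} P? g g-injective g-into = begin
  1 + m
    ≤⟨ +-mono-≤ (countBelow-pos (P? ∩? (_≟ g m)) gm<n (Pgm , refl))
                (injective⇒≤countBelow (P? ∩? ∁? (_≟ g m)) g g-injective others) ⟩
  countBelow n (P? ∩? (_≟ g m)) + countBelow n (P? ∩? ∁? (_≟ g m))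
    ≡⟨ countBelow-partition n P? (_≟ g m) ⟨
  countBelow n P? ∎
  where
  open ≤-Reasoning
  gm<n = proj₁ (g-into ≤-refl)
  Pgm = proj₂ (g-into ≤-refl)
  others : ∀ {i} → i < m → g i < n × (P (g i) × g i ≢ g m)
  others i<m =
    let (gi<n , Pgi) = g-into (m<n⇒m<1+n i<m) in gi<n , Pgi , <⇒≢ i<m ∘ g-injective

covered⇒countBelow≤ : ∀ {n m} {P : Pred ℕ 0ℓ} (P? : Decidable P) (g : ℕ → ℕ) →
  (∀ {k} → k < n → P k → ∃[ i ] i < m × g i ≡ k) → countBelow n P? ≤ m
covered⇒countBelow≤ {m = zero} P? _ covered =
  ≤-reflexive (count-none λ i → n≮0 ∘ proj₁ ∘ proj₂ ∘ covered (toℕ<n i) ∘ does-sound (P? _))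
covered⇒countBelow≤ {n} {suc m} {P} P? g covered = begin
  countBelow n P?
    ≡⟨ countBelow-partition n P? (_≟ g m) ⟩
  countBelow n (P? ∩? (_≟ g m)) + countBelow n (P? ∩? ∁? (_≟ g m))
    ≤⟨ +-mono-≤ (≤-trans (countBelow-mono n (P? ∩? (_≟ g m)) (_≟ g m) (λ _ → proj₂))
                         (countBelow-singleton n (g m)))
                (covered⇒countBelow≤ (P? ∩? ∁? (_≟ g m)) g others) ⟩
  1 + m ∎
  where
  open ≤-Reasoning
  others : ∀ {k} → k < n → P k × k ≢ g m → ∃[ i ] i < m × g i ≡ k
  others k<n (Pk , k≢gm) =
    let (i , i<1+m , gi≡k) = covered k<n Pk
    in i , ≤∧≢⇒< (s≤s⁻¹ i<1+m) (λ i≡m → k≢gm (≡.trans (≡.sym gi≡k) (cong g i≡m))) ,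
       gi≡k

Reach-trans : ∀ {n} {G : Graph n} {u v w} → Reach G u v → Reach G v w → Reach G u w
Reach-trans here r = r
Reach-trans (step e r) r′ = step e (Reach-trans r r′)

Reach-sym : ∀ {n} {G : Graph n} {u v} → Reach G u v → Reach G v u
Reach-sym here = here
Reach-sym {G = G} (step {u} {w} e r) =
  Reach-trans (Reach-sym r) (step (≡.trans (sym G w u) e) here)

descending⇒connected : ∀ {n} (G : Graph (suc n)) →
  (∀ v → ∃[ w ] w Fin.< suc v × adj G (suc v) w ≡ true) → Connected G
descending⇒connected G descend u v =
  Reach-trans (toZero u (<-wellFounded u)) (Reach-sym (toZero v (<-wellFounded v)))
  where
  toZero : ∀ v → Acc Fin._<_ v → Reach G v zero
  toZero zero _ = here
  toZero (suc v) (acc smaller) with descend v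
  ... | w , w<v , e = step e (toZero w (smaller w<v))

module Induced {R : Rel ℕ 0ℓ} (R? : ∀ x y → Dec (R x y)) (R-sym : Symmetric R) where

  induced : (n : ℕ) → Graph n
  induced n .adj v w = not (does (v Fin.≟ w)) ∧ does (R? (toℕ v) (toℕ w))
  induced n .sym v w = cong₂ (λ a b → not a ∧ b)
    (does-⇔ (mk⇔ ≡.sym ≡.sym) (v Fin.≟ w) (w Fin.≟ v))
    (does-⇔ (mk⇔ R-sym R-sym) (R? _ _) (R? _ _))
  induced n .irrefl v =
    cong (λ a → not a ∧ does (R? (toℕ v) (toℕ v))) (dec-true (v Fin.≟ v) refl)

  induced-edge : ∀ {n} {v w : Fin n} →
    toℕ v ≢ toℕ w → R (toℕ v) (toℕ w) → adj (induced n) v w ≡ true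
  induced-edge {v = v} {w} v≢w Rvw =
    cong₂ _∧_ (cong not (dec-false (v Fin.≟ w) (v≢w ∘ cong toℕ))) (dec-true (R? _ _) Rvw)

  induced-closedNbhd : Reflexive R → ∀ {n} (v w : Fin n) →
    inClosedN (induced n) v w ≡ does (R? (toℕ v) (toℕ w))
  induced-closedNbhd R-refl v w with w Fin.≟ v
  ... | yes refl = ≡.sym (dec-true (R? _ _) R-refl)
  ... | no w≢v =
    cong (λ a → not a ∧ does (R? (toℕ v) (toℕ w))) (dec-false (v Fin.≟ w) (w≢v ∘ ≡.sym))

  induced-degree : ∀ {n} (v : Fin n) → degree (induced n) v ≤ countBelow n (R? (toℕ v))
  induced-degree v = count-mono λ w → ∧-elimʳ (not (does (v Fin.≟ w)))
    where
    ∧-elimʳ : ∀ a {b} → T (a ∧ b) → T b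
    ∧-elimʳ true t = t

  induced-strong : Reflexive R → ∀ {n k} →
    (∀ {u v} → u < n → v < n → u ≢ v → k ≤ countBelow n (R? v ∩? ∁? (R? u))) →
    StrongNbhd k (induced n)
  induced-strong R-refl separated u v u≢v =
    ≤-trans (separated (toℕ<n u) (toℕ<n v) (u≢v ∘ toℕ-injective)) (count-mono λ w →
      subst T (cong₂ (λ a b → a ∧ not b) (≡.sym (induced-closedNbhd R-refl v w))
                                         (≡.sym (induced-closedNbhd R-refl u w))))

  induced-connected : (∀ {k} → 0 < k → ∃[ j ] j < k × R k j) →
    ∀ {n} → Connected (induced n)
  induced-connected descends {suc n} = descending⇒connected (induced (suc n)) λ v →
    let (j , j<v , Rvj) = descends {toℕ (suc v)} z<s
        j≡toℕw = ≡.sym (toℕ-fromℕ< (<-trans j<v (toℕ<n (suc v))))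
    in fromℕ< _ , subst (_< toℕ (suc v)) j≡toℕw j<v ,
       induced-edge (subst (toℕ (suc v) ≢_) j≡toℕw (>⇒≢ j<v)) (subst (R _) j≡toℕw Rvj)

m≤n+o∧n≤m+o⇒∣m-n∣≤o : ∀ {m n o} → m ≤ n + o → n ≤ m + o → ∣ m - n ∣ ≤ o
m≤n+o∧n≤m+o⇒∣m-n∣≤o {m} {n} m≤n+o n≤m+o with ∣m-n∣≡[m∸n]∨[n∸m] m n
... | inj₁ eq = subst (_≤ _) (≡.sym eq) (m≤n+o⇒m∸n≤o m n m≤n+o)
... | inj₂ eq = subst (_≤ _) (≡.sym eq) (m≤n+o⇒m∸n≤o n m n≤m+o)

∣m-n∣≤o⇒n≡m∸o+i : ∀ {m n o} → ∣ m - n ∣ ≤ o →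
  ∃[ i ] i < suc (o + o) × m ∸ o + i ≡ n
∣m-n∣≤o⇒n≡m∸o+i {m} {n} {o} ∣m-n∣≤o =
  n ∸ (m ∸ o) , s≤s (m≤n+o⇒m∸n≤o n (m ∸ o) n≤) ,
  m+[n∸m]≡n (m≤n+o⇒m∸n≤o m o m≤o+n)
  where
  open ≤-Reasoning
  m≤o+n : m ≤ o + n
  m≤o+n = begin
    m             ≤⟨ m≤n+∣m-n∣ m n ⟩
    n + ∣ m - n ∣ ≤⟨ +-monoʳ-≤ n ∣m-n∣≤o ⟩
    n + o         ≡⟨ +-comm n o ⟩
    o + n         ∎
  n≤ : n ≤ m ∸ o + (o + o)
  n≤ = begin
    n                 ≤⟨ m≤n+∣n-m∣ n m ⟩
    m + ∣ m - n ∣     ≤⟨ +-monoʳ-≤ m ∣m-n∣≤o ⟩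
    m + o             ≤⟨ +-monoˡ-≤ o (m≤n+m∸n m o) ⟩
    o + (m ∸ o) + o   ≡⟨ cong (_+ o) (+-comm o (m ∸ o)) ⟩
    m ∸ o + o + o     ≡⟨ +-assoc (m ∸ o) o o ⟩
    m ∸ o + (o + o)   ∎

module Grid (q K : ℕ) .{{_ : NonZero q}} where

  offset block : ℕ → ℕ
  offset k = k % q
  block k = k / q

  Near : Rel ℕ 0ℓ
  Near v w = offset v ≡ offset w ⊎ (block v ≡ block w × ∣ offset v - offset w ∣ ≤ K)

  near? : ∀ v w → Dec (Near v w)
  near? v w = offset v ≟ offset w ⊎-dec (block v ≟ block w ×-dec ∣ offset v - offset w ∣ ≤? K)

  Near-sym : Symmetric Near
  Near-sym (inj₁ same) = inj₁ (≡.sym same)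
  Near-sym {v} {w} (inj₂ (same , close)) =
    inj₂ (≡.sym same , subst (_≤ K) (∣-∣-comm (offset v) (offset w)) close)

  apart⇒¬Near : ∀ {u w} → offset w ≢ offset u → block w ≢ block u → ¬ Near u w
  apart⇒¬Near offset≢ block≢ = [ offset≢ ∘ ≡.sym , block≢ ∘ ≡.sym ∘ proj₁ ]′

  open Induced near? Near-sym

  grid : (n : ℕ) → Graph n
  grid = induced

  coords : ∀ k → k ≡ offset k + block k * q
  coords k = m≡m%n+[m/n]*n k q

  offset-coords : ∀ {r} c → r < q → offset (r + c * q) ≡ r
  offset-coords {r} c r<q = ≡.trans ([m+kn]%n≡m%n r c q) (m<n⇒m%n≡m r<q)

  block-coords : ∀ {r} c → r < q → block (r + c * q) ≡ c
  block-coords {r} c r<q = begin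
    (r + c * q) / q    ≡⟨ +-distrib-/ r (c * q) remainders<q ⟩
    r / q + c * q / q  ≡⟨ cong₂ _+_ (m<n⇒m/n≡0 r<q) (m*n/n≡m c q) ⟩
    c                  ∎
    where
    open ≡.≡-Reasoning
    remainders<q : r % q + c * q % q < q
    remainders<q = subst (_< q)
      (≡.sym (≡.trans (cong₂ _+_ (m<n⇒m%n≡m r<q) (m*n%n≡0 c q)) (+-identityʳ r))) r<q

  grid-descends : 1 ≤ K → ∀ {k} → 0 < k → ∃[ j ] j < k × Near k j
  grid-descends 1≤K {k} = subst (λ k → 0 < k → ∃[ j ] j < k × Near k j) (≡.sym (coords k))
    (descend (offset k) (block k) (m%n<n k q))
    where
    descend : ∀ r c → r < q → 0 < r + c * q → ∃[ j ] j < r + c * q × Near (r + c * q) j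
    descend zero zero _ ()
    descend zero (suc c) _ _ =
      c * q , m<n+m (c * q) (>-nonZero⁻¹ q) ,
      inj₁ (≡.trans (m*n%n≡0 (suc c) q) (≡.sym (m*n%n≡0 c q)))
    descend (suc r) c 1+r<q _ = r + c * q , ≤-refl , inj₂ (sameBlock , adjacentOffsets)
      where
      r<q : r < q
      r<q = <-trans (n<1+n r) 1+r<q
      sameBlock : block (suc r + c * q) ≡ block (r + c * q)
      sameBlock = ≡.trans (block-coords c 1+r<q) (≡.sym (block-coords c r<q))
      adjacentOffsets : ∣ offset (suc r + c * q) - offset (r + c * q) ∣ ≤ K
      adjacentOffsets = subst (_≤ K) (≡.sym (begin
        ∣ offset (suc r + c * q) - offset (r + c * q) ∣
          ≡⟨ cong₂ ∣_-_∣ (offset-coords c 1+r<q) (offset-coords c r<q) ⟩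
        ∣ suc r - r ∣  ≡⟨ m≤n⇒∣n-m∣≡n∸m (n≤1+n r) ⟩
        suc r ∸ r      ≡⟨ m+n∸n≡m 1 r ⟩
        1              ∎)) 1≤K
        where open ≡.≡-Reasoning

  grid-connected : 1 ≤ K → ∀ {n} → Connected (grid n)
  grid-connected 1≤K = induced-connected (grid-descends 1≤K)

  grid-degree : ∀ {n b} → n ≤ b * q → (v : Fin n) → degree (grid n) v ≤ b + suc (K + K)
  grid-degree {n} {b} n≤bq v = begin
    degree (grid n) v
      ≤⟨ induced-degree v ⟩
    countBelow n (near? x)
      ≤⟨ countBelow-∪ n sameOffset? closeInBlock? ⟩
    countBelow n sameOffset? + countBelow n closeInBlock?
      ≤⟨ +-mono-≤ (covered⇒countBelow≤ sameOffset? (λ c → offset x + c * q) sameOffset⇒inColumn)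
                  (covered⇒countBelow≤ closeInBlock? (λ i → offset x ∸ K + i + block x * q)
                                       closeInBlock⇒inWindow) ⟩
    b + suc (K + K) ∎
    where
    open ≤-Reasoning
    x = toℕ v
    sameOffset? closeInBlock? : ∀ k → Dec _
    sameOffset? k = offset x ≟ offset k
    closeInBlock? k = block x ≟ block k ×-dec ∣ offset x - offset k ∣ ≤? K
    sameOffset⇒inColumn : ∀ {k} → k < n → offset x ≡ offset k →
      ∃[ c ] c < b × offset x + c * q ≡ k
    sameOffset⇒inColumn {k} k<n same = block k , m<n*o⇒m/o<n (<-≤-trans k<n n≤bq) ,
      ≡.sym (≡.trans (coords k) (cong (_+ block k * q) (≡.sym same)))
    closeInBlock⇒inWindow : ∀ {k} → k < n → block x ≡ block k × ∣ offset x - offset k ∣ ≤ K →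
      ∃[ i ] i < suc (K + K) × offset x ∸ K + i + block x * q ≡ k
    closeInBlock⇒inWindow {k} _ (same , close) =
      let (i , i<1+2K , window≡) = ∣m-n∣≤o⇒n≡m∸o+i close
      in i , i<1+2K ,
         ≡.sym (≡.trans (coords k) (cong₂ (λ o c → o + c * q) (≡.sym window≡) (≡.sym same)))

  module _ {n : ℕ} (K+K≤q : K + K ≤ q) (fits : suc K * q + (K + K) ≤ n)
           (n≤ : n ≤ suc (suc K) * q) where

    Flank : ℕ → ℕ → Set
    Flank v s = ∀ {i} → i < K →
      s + i < q × s + i + block v * q < n × s + i ≢ offset v × ∣ offset v - (s + i) ∣ ≤ K

    flank-below : ∀ {v} → v < n → K ≤ offset v → Flank v (offset v ∸ K)
    flank-below {v} v<n K≤r {i} i<K =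
      <-trans s+i<r (m%n<n v q) , s+i+cq<n , <⇒≢ s+i<r ,
      m≤n+o∧n≤m+o⇒∣m-n∣≤o r≤s+i+K (≤-trans (<⇒≤ s+i<r) (m≤m+n r K))
      where
      r = offset v
      s = r ∸ K
      s+K≡r : s + K ≡ r
      s+K≡r = m∸n+n≡m K≤r
      s+i<r : s + i < r
      s+i<r = subst (s + i <_) s+K≡r (+-monoʳ-< s i<K)
      s+i+cq<n : s + i + block v * q < n
      s+i+cq<n = <-trans (subst (s + i + block v * q <_) (≡.sym (coords v))
                                (+-monoˡ-< (block v * q) s+i<r)) v<n
      r≤s+i+K : r ≤ s + i + K
      r≤s+i+K = subst (_≤ s + i + K) s+K≡r (+-monoˡ-≤ K (m≤m+n s i))

    -- The offsets below 2K exist in every block, including the last, partial one.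
    flank-above : ∀ {v} → v < n → offset v < K → Flank v (suc (offset v))
    flank-above {v} v<n r<K {i} i<K =
      <-≤-trans s+i<K+K K+K≤q , s+i+cq<n , >⇒≢ (s≤s (m≤m+n r i)) ,
      m≤n+o∧n≤m+o⇒∣m-n∣≤o r≤s+i+K s+i≤r+K
      where
      open ≤-Reasoning
      r = offset v
      s+i≤r+K : suc r + i ≤ r + K
      s+i≤r+K = +-monoʳ-< r i<K
      r≤s+i+K : r ≤ suc r + i + K
      r≤s+i+K = ≤-trans (n≤1+n r) (≤-trans (m≤m+n (suc r) i) (m≤m+n (suc r + i) K))
      s+i<K+K : suc r + i < K + K
      s+i<K+K = ≤-<-trans s+i≤r+K (+-monoˡ-< K r<K)
      block≤1+K : block v ≤ suc K
      block≤1+K = s≤s⁻¹ (m<n*o⇒m/o<n (<-≤-trans v<n n≤))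
      s+i+cq<n : suc r + i + block v * q < n
      s+i+cq<n = begin-strict
        suc r + i + block v * q  <⟨ +-monoˡ-< (block v * q) s+i<K+K ⟩
        K + K + block v * q      ≤⟨ +-monoʳ-≤ (K + K) (*-monoˡ-≤ q block≤1+K) ⟩
        K + K + suc K * q        ≡⟨ +-comm (K + K) (suc K * q) ⟩
        suc K * q + (K + K)      ≤⟨ fits ⟩
        n                        ∎

    flank : ∀ {v} → v < n → ∃ (Flank v)
    flank {v} v<n with K ≤? offset v
    ... | yes K≤r = _ , flank-below v<n K≤r
    ... | no K≰r = _ , flank-above v<n (≰⇒> K≰r)

    flank⇒separated : ∀ {u v s} → u ≢ v → offset v ≡ offset u → Flank v s →
      K ≤ countBelow n (near? v ∩? ∁? (near? u))
    flank⇒separated {u} {v} {s} u≢v same flankS =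
      injective⇒≤countBelow (near? v ∩? ∁? (near? u)) g
        (+-cancelˡ-≡ s _ _ ∘ +-cancelʳ-≡ (block v * q) _ _) witness
      where
      g : ℕ → ℕ
      g i = s + i + block v * q
      block≢ : block v ≢ block u
      block≢ eq = u≢v (≡.sym (≡.trans (coords v)
        (≡.trans (cong₂ (λ r c → r + c * q) same eq) (≡.sym (coords u)))))
      witness : ∀ {i} → i < K → g i < n × (Near v (g i) × ¬ Near u (g i))
      witness i<K =
        let (s+i<q , g<n , s+i≢r , close) = flankS i<K
            offset≡ = offset-coords (block v) s+i<q
            block≡ = block-coords (block v) s+i<q
        in g<n ,
           inj₂ (≡.sym block≡ , subst (λ o → ∣ offset v - o ∣ ≤ K) (≡.sym offset≡) close) ,
           apart⇒¬Near (λ e → s+i≢r (≡.trans (≡.sym offset≡) (≡.trans e (≡.sym same))))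
                       (λ e → block≢ (≡.trans (≡.sym block≡) e))

    -- Of v's offset class in the blocks 0, …, K, only the vertex x in u's block can lie in N[u].
    diffOffset-separated : ∀ {u v} → offset v ≢ offset u →
      K ≤ countBelow n (near? v ∩? ∁? (near? u))
    diffOffset-separated {u} {v} offset≢ = s≤s⁻¹ (begin
      suc K
        ≤⟨ injective⇒≤countBelow (separated? ∪? (_≟ x)) g g-injective witness ⟩
      countBelow n (separated? ∪? (_≟ x))
        ≤⟨ countBelow-∪ n separated? (_≟ x) ⟩
      countBelow n separated? + countBelow n (_≟ x)
        ≤⟨ +-monoʳ-≤ (countBelow n separated?) (countBelow-singleton n x) ⟩
      countBelow n separated? + 1
        ≡⟨ +-comm (countBelow n separated?) 1 ⟩
      suc (countBelow n separated?) ∎)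
      where
      open ≤-Reasoning
      separated? = near? v ∩? ∁? (near? u)
      r<q = m%n<n v q
      x = offset v + block u * q
      g : ℕ → ℕ
      g c = offset v + c * q
      g-injective : ∀ {c d} → g c ≡ g d → c ≡ d
      g-injective = *-cancelʳ-≡ _ _ q ∘ +-cancelˡ-≡ (offset v) _ _
      witness : ∀ {c} → c < suc K → g c < n × ((Near v (g c) × ¬ Near u (g c)) ⊎ g c ≡ x)
      witness {c} c<1+K = g<n , separatedOrX
        where
        g<n : g c < n
        g<n = begin-strict
          offset v + c * q     <⟨ +-monoˡ-< (c * q) r<q ⟩
          suc c * q            ≤⟨ *-monoˡ-≤ q c<1+K ⟩
          suc K * q            ≤⟨ m≤m+n (suc K * q) (K + K) ⟩
          suc K * q + (K + K)  ≤⟨ fits ⟩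
          n                    ∎
        separatedOrX : (Near v (g c) × ¬ Near u (g c)) ⊎ g c ≡ x
        separatedOrX with c ≟ block u
        ... | yes refl = inj₂ refl
        ... | no c≢ = inj₁ (inj₁ (≡.sym (offset-coords c r<q)) ,
          apart⇒¬Near (offset≢ ∘ ≡.trans (≡.sym (offset-coords c r<q)))
                      (c≢ ∘ ≡.trans (≡.sym (block-coords c r<q))))

    grid-strong : StrongNbhd K (grid n)
    grid-strong = induced-strong (inj₁ refl) separated
      where
      separated : ∀ {u v} → u < n → v < n → u ≢ v →
        K ≤ countBelow n (near? v ∩? ∁? (near? u))
      separated {u} {v} _ v<n u≢v with offset v ≟ offset u
      ... | yes same = flank⇒separated u≢v same (proj₂ (flank v<n))
      ... | no offset≢ = diffOffset-separated offset≢

blockLength : ℕ → ℕ → ℕ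
blockLength K n = suc (n / (2 + K))

blockLength-fits : ∀ K n → (3 * K + 2) * (2 + K) ≤ n →
  let q = blockLength K n in K + K ≤ q × suc K * q + (K + K) ≤ n × n ≤ (2 + K) * q
blockLength-fits K n large = K+K≤q , fits , n≤
  where
  open ≤-Reasoning
  d = 2 + K
  q₀ = n / d
  2K+[K+2]≡3K+2 : ∀ k → k + k + (k + 2) ≡ 3 * k + 2
  2K+[K+2]≡3K+2 = solve-∀
  distribute : ∀ k q → suc k * suc q + (k + k) ≡ suc k * q + (3 * k + 1)
  distribute = solve-∀
  collect : ∀ k q → suc k * q + q ≡ q * (2 + k)
  collect = solve-∀
  1≤2 : 1 ≤ 2
  1≤2 = s≤s z≤n
  3K+2≤q₀ : 3 * K + 2 ≤ q₀
  3K+2≤q₀ = ≤-trans (≤-reflexive (≡.sym (m*n/n≡m (3 * K + 2) d))) (/-monoˡ-≤ d large)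
  K+K≤q : K + K ≤ suc q₀
  K+K≤q = begin
    K + K                  ≤⟨ m≤m+n (K + K) (K + 2) ⟩
    K + K + (K + 2)        ≡⟨ 2K+[K+2]≡3K+2 K ⟩
    3 * K + 2              ≤⟨ 3K+2≤q₀ ⟩
    q₀                     ≤⟨ n≤1+n q₀ ⟩
    suc q₀                 ∎
  fits : suc K * suc q₀ + (K + K) ≤ n
  fits = begin
    suc K * suc q₀ + (K + K)   ≡⟨ distribute K q₀ ⟩
    suc K * q₀ + (3 * K + 1)   ≤⟨ +-monoʳ-≤ (suc K * q₀) (≤-trans (+-monoʳ-≤ (3 * K) 1≤2) 3K+2≤q₀) ⟩
    suc K * q₀ + q₀            ≡⟨ collect K q₀ ⟩
    q₀ * d                     ≤⟨ m/n*n≤m n d ⟩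
    n                          ∎
  n≤ : n ≤ d * suc q₀
  n≤ = begin
    n                  ≡⟨ m≡m%n+[m/n]*n n d ⟩
    n % d + q₀ * d     ≤⟨ +-monoˡ-≤ (q₀ * d) (<⇒≤ (m%n<n n d)) ⟩
    d + q₀ * d         ≡⟨ *-comm (suc q₀) d ⟩
    d * suc q₀         ∎

[3K+2][2+K]≤160[1+K]² : ∀ K → (3 * K + 2) * (2 + K) ≤ 160 * suc K ^ 2
[3K+2][2+K]≤160[1+K]² K =
  ≤-trans (m≤m+n _ (157 * K * K + 312 * K + 156)) (≤-reflexive (expand K))
  where
  expand : ∀ k →
    (3 * k + 2) * (2 + k) + (157 * k * k + 312 * k + 156) ≡ 160 * (suc k * (suc k * 1))
  expand = solve-∀

[2+K]+[1+2K]≤8[1+K] : ∀ K → 2 + K + suc (K + K) ≤ 8 * suc K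
[2+K]+[1+2K]≤8[1+K] K = ≤-trans (m≤m+n _ (5 * K + 5)) (≤-reflexive (expand K))
  where
  expand : ∀ k → 2 + k + suc (k + k) + (5 * k + 5) ≡ 8 * suc k
  expand = solve-∀

lemma1 : ∃ λ (C : ℕ) → (y : ℕ) → 3 ≤ y → (n : ℕ) → C ≤ n → 160 * y ^ 2 + 1 ≤ n →
    ∃ λ (G : Graph n) → Connected G × StrongNbhd (y ∸ 1) G ×
      ((v : Fin n) → degree G v ≤ 8 * y ⊎ LeThirtyTwoLog (degree G v) n)
lemma1 = 0 , λ where
  (suc K) (s≤s 2≤K) n _ large →
    let (K+K≤q , fits , n≤) = blockLength-fits K n
          (≤-trans ([3K+2][2+K]≤160[1+K]² K) (≤-trans (m≤m+n _ 1) large))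
        open Grid (blockLength K n) K
    in grid n , grid-connected (≤-trans (n≤1+n 1) 2≤K) , grid-strong K+K≤q fits n≤ ,
       λ v → inj₁ (≤-trans (grid-degree n≤ v) ([2+K]+[1+2K]≤8[1+K] K))
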